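{- Let $\Gamma$ be a distance-regular graph with diameter $D\ge3$, fix a vertex $x$, and let $v$ be a vector in $E^*_1V$ which is orthogonal to $s_1$. Then for $0\le i\le D-1$, $$E^*_{i+1}A_iv-E^*_iA_{i+1}v=\sum_{h=0}^iA_hv.$$
   Context: $\Gamma=(X,R)$ is a finite connected distance-regular graph with path-length distance $\partial$ and diameter $D$. $V=\mathbb{C}^X$ with Hermitian inner product $\langle u,w\rangle=u^t\overline w$ and standard basis vectors $\hat y$ ($y\in X$). For $0\le i\le D$, $A_i$ is the $i$th distance matrix ($yz$-entry $1$ if $\partial(y,z)=i$, else $0$); $E^*_i$ is the diagonal matrix with $yy$-entry $1$ if $\partial(x,y)=i$, else $0$, with $E^*_i=0$ for $i<0$ or $i>D$; $s_i=\sum_{y:\partial(x,y)=i}\hat y$. -}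

module Defs where

open import Level using (Level; suc; _⊔_)
open import Data.Nat using (ℕ; zero; _≤_; _≟_) renaming (suc to 1+)
open import Data.Fin using (Fin; toℕ)
open import Data.Bool using (Bool; true; false; _∧_; if_then_else_)
open import Data.List using (List; length; filter; allFin)
open import Data.Product using (Σ; _×_; ∃₂)
open import Relation.Nullary using (¬_)
open import Relation.Nullary.Decidable using (⌊_⌋)
open import Relation.Binary.PropositionalEquality using (_≡_)
open import Algebra.Bundles using (CommutativeRing)
import Algebra.Definitions.RawMonoid as RM

data Walk {n : ℕ} (_~_ : Fin n → Fin n → Set) : Fin n → Fin n → ℕ → Set where
  here : ∀ {y} → Walk _~_ y y 0
  step : ∀ {y w z k} → y ~ w → Walk _~_ w z k → Walk _~_ y z (1+ k)

card : ∀ {n} → (Fin n → Bool) → ℕ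
card {n} p = length (filter (λ w → Data.Bool._≟_ (p w) true) (allFin n))
  where import Data.Bool

-- A finite connected (simple, undirected) distance-regular graph with
-- vertex set X = Fin n.  ∂ is required to be the path-length distance:
-- a walk of length ∂ y z exists from y to z (so Γ is connected), and every
-- walk from y to z has length ≥ ∂ y z.
record DRG (n : ℕ) : Set₁ where
  field
    _~_     : Fin n → Fin n → Set
    ~-sym   : ∀ {y z} → y ~ z → z ~ y
    ~-irr   : ∀ {y} → ¬ (y ~ y)
    ∂       : Fin n → Fin n → ℕ
    ∂-walk  : ∀ y z → Walk _~_ y z (∂ y z)
    ∂-min   : ∀ y z k → Walk _~_ y z k → ∂ y z ≤ k
    regular : ∀ h i j y z y′ z′ → ∂ y z ≡ h → ∂ y′ z′ ≡ h →
              card (λ w → ⌊ ∂ y w ≟ i ⌋ ∧ ⌊ ∂ z w ≟ j ⌋)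
                ≡ card (λ w → ⌊ ∂ y′ w ≟ i ⌋ ∧ ⌊ ∂ z′ w ≟ j ⌋)

IsDiameter : ∀ {n} → DRG n → ℕ → Set
IsDiameter {n} Γ D = (∀ y z → ∂ y z ≤ D) × ∃₂ (λ y z → ∂ y z ≡ D)
  where open DRG Γ

module LinAlg {c ℓ : Level} (R : CommutativeRing c ℓ) {n : ℕ} (Γ : DRG n) where
  open CommutativeRing R
  open DRG Γ

  Vec : Set c
  Vec = Fin n → Carrier

  Σ[_] : ∀ {m} → (Fin m → Carrier) → Carrier
  Σ[ f ] = RM.sum +-rawMonoid f

  A : ℕ → Fin n → Fin n → Carrier
  A i y z = if ⌊ ∂ y z ≟ i ⌋ then 1# else 0#

  _·_ : (Fin n → Fin n → Carrier) → Vec → Vec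
  (M · v) y = Σ[ (λ z → M y z * v z) ]

  E* : Fin n → ℕ → Fin n → Fin n → Carrier
  E* x i y z = if ⌊ ∂ x y ≟ i ⌋ ∧ ⌊ Data.Fin._≟_ y z ⌋ then 1# else 0#
    where import Data.Fin

  s : Fin n → ℕ → Vec
  s x i y = if ⌊ ∂ x y ≟ i ⌋ then 1# else 0#

  _≈ᵥ_ : Vec → Vec → Set ℓ
  u ≈ᵥ w = ∀ y → u y ≈ w y

  _∈E*V_ : Vec → (Fin n → Fin n → Carrier) → Set ℓ
  v ∈E*V E = (E · v) ≈ᵥ v

  -- inner product ⟨u , w⟩ = u^t w  (w real/0-1 here, so no conjugation needed)
  ⟨_,_⟩ : Vec → Vec → Carrier
  ⟨ u , w ⟩ = Σ[ (λ y → u y * w y) ]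

  _-ᵥ_ : Vec → Vec → Vec
  (u -ᵥ w) y = u y - w y

  Σ≤ : ℕ → (ℕ → Vec) → Vec
  Σ≤ i f y = Σ[ (λ (h : Fin (1+ i)) → f (toℕ h) y) ]

{-# OPTIONS --safe #-}
-- Only the vertices z adjacent to x carry v, and for them ∂(y,z) differs from
-- j = ∂(x,y) by at most one.  On that range of distances the indicator identity
--   [j = i+1][∂(y,z) = i] + [j ≤ i] = [j = i][∂(y,z) = i+1] + [∂(y,z) ≤ i]
-- holds, and pairing it with v turns the constant term [j ≤ i] into
-- [j ≤ i]⟨v, s₁⟩ = 0.
module Submission where

open import Defs
open import Level using (Level)
open import Data.Nat using (ℕ; _≤_; _<_; suc)
open import Data.Fin using (Fin)
open import Algebra.Bundles using (CommutativeRing)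

open import Data.Nat.Base using (zero; s≤s; s≤s⁻¹; _≡ᵇ_; _<ᵇ_)
open import Data.Nat.Properties using (_≟_)
open import Data.Fin.Base using (toℕ)
open import Data.Fin.Properties using (suc-injective) renaming (_≟_ to _≟ᶠ_)
open import Data.Bool.Base using (Bool; true; false; _∧_; if_then_else_)
open import Data.Bool.Properties using (∧-zeroʳ; ∧-identityʳ)
open import Data.Product.Base using (_×_; _,_; proj₁; proj₂)
open import Function.Base using (_∘_)
open import Relation.Nullary.Decidable
  using (Dec; yes; no; does; ⌊_⌋; isYes≗does; dec-yes; dec-no; dec-false)
open import Relation.Binary.PropositionalEquality as ≡ using (_≡_; _≢_; cong; cong₂; subst)

module Distance {n : ℕ} (Γ : DRG n) where
  open DRG Γ
  open import Data.Nat.Base using (_+_)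
  open import Data.Nat.Properties
    using (+-comm; ≤-antisym; ≤-trans; ≤-reflexive; module ≤-Reasoning)

  _++ʷ_ : ∀ {y w z k m} → Walk _~_ y w k → Walk _~_ w z m → Walk _~_ y z (k + m)
  here     ++ʷ q = q
  step e p ++ʷ q = step e (p ++ʷ q)

  reverseʷ : ∀ {y z k} → Walk _~_ y z k → Walk _~_ z y k
  reverseʷ here = here
  reverseʷ {k = suc k} (step e p) =
    subst (Walk _~_ _ _) (+-comm k 1) (reverseʷ p ++ʷ step (~-sym e) here)

  ∂-triangle : ∀ y w z → ∂ y z ≤ ∂ y w + ∂ w z
  ∂-triangle y w z = ∂-min y z _ (∂-walk y w ++ʷ ∂-walk w z)

  ∂-sym : ∀ y z → ∂ y z ≡ ∂ z y
  ∂-sym y z = ≤-antisym (∂-min y z _ (reverseʷ (∂-walk z y)))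
                        (∂-min z y _ (reverseʷ (∂-walk y z)))

  ∂-neighbour-bounds : ∀ x y z → ∂ x z ≡ 1 → ∂ y z ≤ suc (∂ x y) × ∂ x y ≤ suc (∂ y z)
  ∂-neighbour-bounds x y z ∂xz≡1 = y→z , x→y
    where
    open ≤-Reasoning
    y→z : ∂ y z ≤ suc (∂ x y)
    y→z = begin
      ∂ y z           ≤⟨ ∂-triangle y x z ⟩
      ∂ y x + ∂ x z   ≡⟨ cong₂ _+_ (∂-sym y x) ∂xz≡1 ⟩
      ∂ x y + 1       ≡⟨ +-comm (∂ x y) 1 ⟩
      suc (∂ x y)     ∎
    x→y : ∂ x y ≤ suc (∂ y z)
    x→y = ≤-trans (∂-triangle x z y) (≤-reflexive (cong₂ _+_ ∂xz≡1 (∂-sym z y)))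

module Layers {c ℓ : Level} (R : CommutativeRing c ℓ) {n : ℕ} (Γ : DRG n) where
  open CommutativeRing R
  open DRG Γ
  open LinAlg R Γ
  open Distance Γ
  open import Algebra.Properties.Semiring.Sum semiring
    using (sum-cong-≋; sum-replicate-zero; ∑-comm; ∑-distrib-+; *-distribˡ-sum; *-distribʳ-sum)
  open import Algebra.Properties.Group +-group using (//-rightDividesʳ)
  open import Relation.Binary.Reasoning.Setoid setoid

  𝟙 : Bool → Carrier
  𝟙 b = if b then 1# else 0#

  -- ⌊ suc m ≟ suc k ⌋ does not reduce to ⌊ m ≟ k ⌋, whereas suc m ≡ᵇ suc k reduces to
  -- m ≡ᵇ k; the recursions below therefore work with _≡ᵇ_ and _<ᵇ_.
  𝟙-⌊⌋ : ∀ {p} {P : Set p} (P? : Dec P) → 𝟙 ⌊ P? ⌋ ≡ 𝟙 (does P?)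
  𝟙-⌊⌋ P? = cong 𝟙 (isYes≗does P?)

  products-vanish : ∀ {a b r} → 0# * a + r ≈ b * 0# + r
  products-vanish {a} {b} = +-congʳ (trans (zeroˡ a) (sym (zeroʳ b)))

  units-swap : 0# * 0# + 1# ≈ 1# * 1# + 0#
  units-swap = begin
    0# * 0# + 1#  ≈⟨ +-congʳ (zeroˡ 0#) ⟩
    0# + 1#       ≈⟨ +-comm 0# 1# ⟩
    1# + 0#       ≈⟨ +-congʳ (sym (*-identityˡ 1#)) ⟩
    1# * 1# + 0#  ∎

  layer-indicator-identity : ∀ j d i → d ≤ suc j → j ≤ suc d →
    𝟙 (j ≡ᵇ suc i) * 𝟙 (d ≡ᵇ i) + 𝟙 (j <ᵇ suc i)
      ≈ 𝟙 (j ≡ᵇ i) * 𝟙 (d ≡ᵇ suc i) + 𝟙 (d <ᵇ suc i)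
  layer-indicator-identity (suc j) (suc d) (suc i) d≤1+j j≤1+d =
    layer-indicator-identity j d i (s≤s⁻¹ d≤1+j) (s≤s⁻¹ j≤1+d)
  layer-indicator-identity zero          zero          i       _        _        = products-vanish
  layer-indicator-identity zero          (suc zero)    zero    _        _        = units-swap
  layer-indicator-identity zero          (suc zero)    (suc i) _        _        = products-vanish
  layer-indicator-identity zero          (suc (suc d)) i       (s≤s ()) _
  layer-indicator-identity (suc zero)    zero          zero    _        _        = sym units-swap
  layer-indicator-identity (suc zero)    zero          (suc i) _        _        = products-vanish
  layer-indicator-identity (suc (suc j)) zero          i       _        (s≤s ())
  layer-indicator-identity (suc j)       (suc d)       zero    _        _        = sym products-vanish

  ∑-≡ᵇ-toℕ : ∀ m d → Σ[ (λ (h : Fin m) → 𝟙 (d ≡ᵇ toℕ h)) ] ≈ 𝟙 (d <ᵇ m)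
  ∑-≡ᵇ-toℕ zero    d       = refl
  ∑-≡ᵇ-toℕ (suc m) zero    = trans (+-congˡ (sum-replicate-zero m)) (+-identityʳ 1#)
  ∑-≡ᵇ-toℕ (suc m) (suc d) = trans (+-identityˡ _) (∑-≡ᵇ-toℕ m d)

  ∑-concentrated : ∀ {m} (y : Fin m) (f : Fin m → Carrier) →
                   (∀ z → y ≢ z → f z ≈ 0#) → Σ[ f ] ≈ f y
  ∑-concentrated {suc m} Fin.zero f f≈0 = trans (+-congˡ rest≈0) (+-identityʳ _)
    where
    rest≈0 : Σ[ (λ z → f (Fin.suc z)) ] ≈ 0#
    rest≈0 = trans (sum-cong-≋ {m} (λ z → f≈0 (Fin.suc z) λ ())) (sum-replicate-zero m)
  ∑-concentrated (Fin.suc y) f f≈0 = trans (+-cong (f≈0 Fin.zero λ ()) rest≈fy) (+-identityˡ _)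
    where
    rest≈fy : Σ[ (λ z → f (Fin.suc z)) ] ≈ f (Fin.suc y)
    rest≈fy = ∑-concentrated y (λ z → f (Fin.suc z))
                             (λ z y≢z → f≈0 (Fin.suc z) (y≢z ∘ suc-injective))

  E*-· : ∀ x k (w : Vec) y → (E* x k · w) y ≈ 𝟙 (∂ x y ≡ᵇ k) * w y
  E*-· x k w y = trans (∑-concentrated y _ off-diagonal) (*-congʳ diagonal)
    where
    off-diagonal : ∀ z → y ≢ z → E* x k y z * w z ≈ 0#
    off-diagonal z y≢z = trans (*-congʳ (reflexive (cong 𝟙 vanishes))) (zeroˡ (w z))
      where
      vanishes : ⌊ ∂ x y ≟ k ⌋ ∧ ⌊ y ≟ᶠ z ⌋ ≡ false
      vanishes = ≡.trans (cong (λ b → ⌊ ∂ x y ≟ k ⌋ ∧ ⌊ b ⌋) (dec-no (y ≟ᶠ z) y≢z))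
                         (∧-zeroʳ _)
    diagonal : E* x k y y ≈ 𝟙 (∂ x y ≡ᵇ k)
    diagonal = begin
      𝟙 (⌊ ∂ x y ≟ k ⌋ ∧ ⌊ y ≟ᶠ y ⌋)
        ≡⟨ cong (λ b → 𝟙 (⌊ ∂ x y ≟ k ⌋ ∧ ⌊ b ⌋)) (proj₂ (dec-yes (y ≟ᶠ y) ≡.refl)) ⟩
      𝟙 (⌊ ∂ x y ≟ k ⌋ ∧ true)  ≡⟨ cong 𝟙 (∧-identityʳ _) ⟩
      𝟙 ⌊ ∂ x y ≟ k ⌋            ≡⟨ 𝟙-⌊⌋ (∂ x y ≟ k) ⟩
      𝟙 (∂ x y ≡ᵇ k)              ∎

  ⟨⟩-comm : ∀ u w → ⟨ u , w ⟩ ≈ ⟨ w , u ⟩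
  ⟨⟩-comm u w = sum-cong-≋ {n} (λ z → *-comm (u z) (w z))

  ⟨⟩-distribʳ-+ : ∀ f g w → ⟨ (λ z → f z + g z) , w ⟩ ≈ ⟨ f , w ⟩ + ⟨ g , w ⟩
  ⟨⟩-distribʳ-+ f g w =
    trans (sum-cong-≋ {n} (λ z → distribʳ (w z) (f z) (g z))) (∑-distrib-+ {n} _ _)

  ⟨⟩-*ˡ : ∀ a f w → ⟨ (λ z → a * f z) , w ⟩ ≈ a * ⟨ f , w ⟩
  ⟨⟩-*ˡ a f w = trans (sum-cong-≋ {n} (λ z → *-assoc a (f z) (w z))) (sym (*-distribˡ-sum {n} a _))

  A-entry : ∀ k y z → A k y z ≡ 𝟙 (∂ y z ≡ᵇ k)
  A-entry k y z = 𝟙-⌊⌋ (∂ y z ≟ k)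

  Σ≤-A· : ∀ i (w : Vec) y → Σ≤ i (λ h → A h · w) y ≈ ⟨ (λ z → 𝟙 (∂ y z <ᵇ suc i)) , w ⟩
  Σ≤-A· i w y = begin
    Σ[ (λ (h : Fin (suc i)) → Σ[ (λ z → A (toℕ h) y z * w z) ]) ]
      ≈⟨ ∑-comm (λ (h : Fin (suc i)) z → A (toℕ h) y z * w z) ⟩
    Σ[ (λ z → Σ[ (λ (h : Fin (suc i)) → A (toℕ h) y z * w z) ]) ]
      ≈⟨ sum-cong-≋ {n} (λ z → sym (*-distribʳ-sum (w z) (λ (h : Fin (suc i)) → A (toℕ h) y z))) ⟩
    Σ[ (λ z → Σ[ (λ (h : Fin (suc i)) → A (toℕ h) y z) ] * w z) ]
      ≈⟨ sum-cong-≋ {n} (λ z → *-congʳ (row-sum z)) ⟩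
    ⟨ (λ z → 𝟙 (∂ y z <ᵇ suc i)) , w ⟩
      ∎
    where
    row-sum : ∀ z → Σ[ (λ (h : Fin (suc i)) → A (toℕ h) y z) ] ≈ 𝟙 (∂ y z <ᵇ suc i)
    row-sum z = trans (sum-cong-≋ {suc i} (λ h → reflexive (A-entry (toℕ h) y z)))
                      (∑-≡ᵇ-toℕ (suc i) (∂ y z))

  module _ (x : Fin n) (v : Vec) (v∈E*₁V : v ∈E*V (E* x 1)) (v⊥s₁ : ⟨ v , s x 1 ⟩ ≈ 0#) where

    vanishes-off-Γ₁ : ∀ z → ∂ x z ≢ 1 → v z ≈ 0#
    vanishes-off-Γ₁ z ∂xz≢1 = begin
      v z                   ≈⟨ sym (v∈E*₁V z) ⟩
      (E* x 1 · v) z        ≈⟨ E*-· x 1 v z ⟩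
      𝟙 (∂ x z ≡ᵇ 1) * v z  ≡⟨ cong (λ b → 𝟙 b * v z) (dec-false (∂ x z ≟ 1) ∂xz≢1) ⟩
      0# * v z              ≈⟨ zeroˡ (v z) ⟩
      0#                    ∎

    ⟨⟩-congˡ-on-Γ₁ : ∀ {f g} → (∀ z → ∂ x z ≡ 1 → f z ≈ g z) → ⟨ f , v ⟩ ≈ ⟨ g , v ⟩
    ⟨⟩-congˡ-on-Γ₁ {f} {g} f≈g = sum-cong-≋ {n} agree
      where
      agree : ∀ z → f z * v z ≈ g z * v z
      agree z with ∂ x z ≟ 1
      ... | yes ∂xz≡1 = *-congʳ (f≈g z ∂xz≡1)
      ... | no  ∂xz≢1 = trans (vanish f) (sym (vanish g))
        where
        vanish : ∀ h → h z * v z ≈ 0#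
        vanish h = trans (*-congˡ (vanishes-off-Γ₁ z ∂xz≢1)) (zeroʳ (h z))

    ⟨const,v⟩≈0 : ∀ a → ⟨ (λ _ → a) , v ⟩ ≈ 0#
    ⟨const,v⟩≈0 a = begin
      ⟨ (λ _ → a) , v ⟩            ≈⟨ ⟨⟩-congˡ-on-Γ₁ a≈a·s₁ ⟩
      ⟨ (λ z → a * s x 1 z) , v ⟩  ≈⟨ ⟨⟩-*ˡ a (s x 1) v ⟩
      a * ⟨ s x 1 , v ⟩            ≈⟨ *-congˡ (trans (⟨⟩-comm (s x 1) v) v⊥s₁) ⟩
      a * 0#                       ≈⟨ zeroʳ a ⟩
      0#                           ∎
      where
      a≈a·s₁ : ∀ z → ∂ x z ≡ 1 → a ≈ a * s x 1 z
      a≈a·s₁ z ∂xz≡1 = sym (trans (*-congˡ (reflexive s₁z≡1)) (*-identityʳ a))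
        where
        s₁z≡1 : s x 1 z ≡ 1#
        s₁z≡1 = ≡.trans (𝟙-⌊⌋ (∂ x z ≟ 1)) (cong (λ m → 𝟙 (m ≡ᵇ 1)) ∂xz≡1)

    E*-layer-difference : ∀ i → ((E* x (suc i) · (A i · v)) -ᵥ (E* x i · (A (suc i) · v)))
                                  ≈ᵥ Σ≤ i (λ h → A h · v)
    E*-layer-difference i y = begin
      (E* x (suc i) · (A i · v)) y - (E* x i · (A (suc i) · v)) y
        ≈⟨ +-cong (E*-· x (suc i) (A i · v) y) (-‿cong (E*-· x i (A (suc i) · v) y)) ⟩
      a - b        ≈⟨ +-congʳ a≈r+b ⟩
      (r + b) - b  ≈⟨ //-rightDividesʳ b r ⟩
      r            ≈⟨ sym (Σ≤-A· i v y) ⟩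
      Σ≤ i (λ h → A h · v) y ∎
      where
      j = ∂ x y
      a = 𝟙 (j ≡ᵇ suc i) * ⟨ A i y , v ⟩
      b = 𝟙 (j ≡ᵇ i) * ⟨ A (suc i) y , v ⟩
      r = ⟨ (λ z → 𝟙 (∂ y z <ᵇ suc i)) , v ⟩

      layers : ∀ z → ∂ x z ≡ 1 →
        𝟙 (j ≡ᵇ suc i) * A i y z + 𝟙 (j <ᵇ suc i)
          ≈ 𝟙 (j ≡ᵇ i) * A (suc i) y z + 𝟙 (∂ y z <ᵇ suc i)
      layers z ∂xz≡1 = begin
        𝟙 (j ≡ᵇ suc i) * A i y z + 𝟙 (j <ᵇ suc i)
          ≡⟨ cong (λ t → 𝟙 (j ≡ᵇ suc i) * t + 𝟙 (j <ᵇ suc i)) (A-entry i y z) ⟩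
        𝟙 (j ≡ᵇ suc i) * 𝟙 (∂ y z ≡ᵇ i) + 𝟙 (j <ᵇ suc i)
          ≈⟨ layer-indicator-identity j (∂ y z) i ∂yz≤1+j j≤1+∂yz ⟩
        𝟙 (j ≡ᵇ i) * 𝟙 (∂ y z ≡ᵇ suc i) + 𝟙 (∂ y z <ᵇ suc i)
          ≡⟨ cong (λ t → 𝟙 (j ≡ᵇ i) * t + 𝟙 (∂ y z <ᵇ suc i)) (≡.sym (A-entry (suc i) y z)) ⟩
        𝟙 (j ≡ᵇ i) * A (suc i) y z + 𝟙 (∂ y z <ᵇ suc i) ∎
        where
        ∂yz≤1+j = proj₁ (∂-neighbour-bounds x y z ∂xz≡1)
        j≤1+∂yz = proj₂ (∂-neighbour-bounds x y z ∂xz≡1)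

      a≈r+b : a ≈ r + b
      a≈r+b = begin
        a
          ≈⟨ sym (+-identityʳ a) ⟩
        a + 0#
          ≈⟨ +-congˡ (sym (⟨const,v⟩≈0 _)) ⟩
        a + ⟨ (λ _ → 𝟙 (j <ᵇ suc i)) , v ⟩
          ≈⟨ +-congʳ (sym (⟨⟩-*ˡ _ (A i y) v)) ⟩
        ⟨ (λ z → 𝟙 (j ≡ᵇ suc i) * A i y z) , v ⟩ + ⟨ (λ _ → 𝟙 (j <ᵇ suc i)) , v ⟩
          ≈⟨ sym (⟨⟩-distribʳ-+ _ _ v) ⟩
        ⟨ (λ z → 𝟙 (j ≡ᵇ suc i) * A i y z + 𝟙 (j <ᵇ suc i)) , v ⟩
          ≈⟨ ⟨⟩-congˡ-on-Γ₁ layers ⟩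
        ⟨ (λ z → 𝟙 (j ≡ᵇ i) * A (suc i) y z + 𝟙 (∂ y z <ᵇ suc i)) , v ⟩
          ≈⟨ ⟨⟩-distribʳ-+ _ _ v ⟩
        ⟨ (λ z → 𝟙 (j ≡ᵇ i) * A (suc i) y z) , v ⟩ + r
          ≈⟨ +-congʳ (⟨⟩-*ˡ _ (A (suc i) y) v) ⟩
        b + r
          ≈⟨ +-comm b r ⟩
        r + b
          ∎

corollary3p3 : ∀ {c ℓ : Level} (R : CommutativeRing c ℓ) {n : ℕ} (Γ : DRG n)
    (D : ℕ) → IsDiameter Γ D → 3 ≤ D → (x : Fin n) →
    let open CommutativeRing R
        open LinAlg R Γ
    in (v : Fin n → Carrier) → v ∈E*V (E* x 1) → ⟨ v , s x 1 ⟩ ≈ 0# →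
       ∀ i → i < D →
       ((E* x (suc i) · (A i · v)) -ᵥ (E* x i · (A (suc i) · v)))
         ≈ᵥ Σ≤ i (λ h → A h · v)
corollary3p3 R Γ _ _ _ x v v∈E*₁V v⊥s₁ i _ =
  Layers.E*-layer-difference R Γ x v v∈E*₁V v⊥s₁ i
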